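{- Every tree converges to the empty graph under the operator $KB_e$, i.e. $KB_e^k(T)$ is the empty graph for all sufficiently large $k$.
   Context: All graphs are finite, simple and undirected. A biclique of a graph $G$ is a maximal induced complete bipartite subgraph of $G$. The edge-biclique graph $KB_e(G)$ has one vertex for each biclique of $G$, two vertices being adjacent when the corresponding bicliques share at least one edge. Iterates: $KB_e^0(G)=G$, $KB_e^k(G)=KB_e(KB_e^{k-1}(G))$. -}

module Defs where

open import Data.Nat using (ℕ; zero; suc; _≤_)
open import Data.Bool using (Bool; true; false; _∧_; _∨_; not; if_then_else_)
open import Data.Fin using (Fin)
open import Data.Vec using (Vec; []; _∷_; lookup)
open import Data.List using (List; []; _∷_; [_]; concatMap; allFin; filterᵇ; length; _++_)
open import Data.Bool.ListAction using (all; any)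
import Data.List as L
open import Data.List.Relation.Unary.Unique.Propositional using (Unique)
open import Data.Product using (Σ; ∃-syntax; _×_)
open import Relation.Binary.PropositionalEquality using (_≡_)

record Graph : Set where
  field
    n   : ℕ
    adj : Fin n → Fin n → Bool
open Graph public

record Simple (G : Graph) : Set where
  field
    symm    : ∀ u v → adj G u v ≡ adj G v u
    irrefl  : ∀ u → adj G u u ≡ false

Sub : ℕ → Set
Sub n = Vec Bool n

subsets : ∀ n → List (Sub n)
subsets zero    = [ [] ]
subsets (suc n) = concatMap (λ s → (false ∷ s) ∷ (true ∷ s) ∷ []) (subsets n)

_∈ᵇ_ : ∀ {n} → Fin n → Sub n → Bool
i ∈ᵇ S = lookup S i

eqB : Bool → Bool → Bool
eqB true  b = b
eqB false b = not b

_==ˢ_ : ∀ {n} → Sub n → Sub n → Bool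
[]      ==ˢ []      = true
(a ∷ s) ==ˢ (b ∷ t) = eqB a b ∧ (s ==ˢ t)

_⊆ᵇ_ : ∀ {n} → Sub n → Sub n → Bool
_⊆ᵇ_ {n} S T = all (λ i → not (i ∈ᵇ S) ∨ (i ∈ᵇ T)) (allFin n)

nonemptyᵇ : ∀ {n} → Sub n → Bool
nonemptyᵇ {n} S = any (λ i → i ∈ᵇ S) (allFin n)

diffᵇ : ∀ {n} → Fin n → Sub n → Sub n → Bool
diffᵇ i S X = (i ∈ᵇ S) ∧ not (i ∈ᵇ X)

module _ (G : Graph) where
  private V = allFin (n G)

  independentᵇ : Sub (n G) → Bool
  independentᵇ X = all (λ u → all (λ v → not ((u ∈ᵇ X) ∧ (v ∈ᵇ X) ∧ adj G u v)) V) V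

  bipartitionᵇ : Sub (n G) → Sub (n G) → Bool
  bipartitionᵇ S X =
    (X ⊆ᵇ S) ∧ nonemptyᵇ X ∧ any (λ i → diffᵇ i S X) V
    ∧ independentᵇ X
    ∧ all (λ u → all (λ v → not (diffᵇ u S X ∧ diffᵇ v S X ∧ adj G u v)) V) V
    ∧ all (λ u → all (λ v → not ((u ∈ᵇ X) ∧ diffᵇ v S X) ∨ adj G u v) V) V

  completeBipartiteᵇ : Sub (n G) → Bool
  completeBipartiteᵇ S = any (bipartitionᵇ S) (subsets (n G))

  isBicliqueᵇ : Sub (n G) → Bool
  isBicliqueᵇ S = completeBipartiteᵇ S
    ∧ all (λ T → not ((S ⊆ᵇ T) ∧ not (T ⊆ᵇ S) ∧ completeBipartiteᵇ T)) (subsets (n G))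

  -- list of all bicliques of G (each exactly once)
  bicliques : List (Sub (n G))
  bicliques = filterᵇ isBicliqueᵇ (subsets (n G))

  shareEdgeᵇ : Sub (n G) → Sub (n G) → Bool
  shareEdgeᵇ S T = any (λ u → any (λ v →
    (u ∈ᵇ S) ∧ (v ∈ᵇ S) ∧ (u ∈ᵇ T) ∧ (v ∈ᵇ T) ∧ adj G u v) V) V

KBe : Graph → Graph
KBe G = record
  { n   = length (bicliques G)
  ; adj = λ i j → let S = L.lookup (bicliques G) i
                      T = L.lookup (bicliques G) j
                  in not (S ==ˢ T) ∧ shareEdgeᵇ G S T
  }

KBe^ : ℕ → Graph → Graph
KBe^ zero    G = G
KBe^ (suc k) G = KBe (KBe^ k G)

data Walk (G : Graph) : Fin (n G) → Fin (n G) → Set where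
  here : ∀ {u} → Walk G u u
  step : ∀ {u w v} → adj G u w ≡ true → Walk G w v → Walk G u v

Connected : Graph → Set
Connected G = ∀ u v → Walk G u v

data Path (G : Graph) : List (Fin (n G)) → Set where
  single : ∀ {u} → Path G (u ∷ [])
  cons   : ∀ {u w vs} → adj G u w ≡ true → Path G (w ∷ vs) → Path G (u ∷ w ∷ vs)

record Cycle (G : Graph) : Set where
  field
    first  : Fin (n G)
    middle : Fin (n G)
    rest   : List (Fin (n G))
    last   : Fin (n G)
    distinct : Unique (first ∷ middle ∷ rest L.∷ʳ last)
    path     : Path G (first ∷ middle ∷ rest L.∷ʳ last)
    closing  : adj G last first ≡ true

Acyclic : Graph → Set
Acyclic G = Cycle G → Data.Empty.⊥
  where import Data.Empty

IsTree : Graph → Set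
IsTree G = Simple G × Connected G × Acyclic G

-- In a forest every biclique is the closed neighbourhood N[c] of a non-isolated vertex c,
-- its centre, and distinct bicliques have distinct centres.  Two such stars sharing an edge
-- must have the two endpoints of that edge as centres, so the centre map is an injective
-- homomorphism KB_e(G) → G and KB_e(G) is again a forest.  A nonempty forest has a vertex w
-- of degree at most one; w is isolated, or its neighbour u has a further neighbour (so N[w]
-- lies strictly inside the star N[u]), or wu is an isolated edge (so N[w] = N[u]).  In each
-- case some vertex is not a centre, so KB_e(G) has fewer vertices than G, and |V(T)|
-- iterations empty any forest T.

module Submission where

open import Defs
open import Data.Bool using (Bool; true; false; _∧_; _∨_; not)
import Data.Bool as Bool
open import Data.Bool.ListAction using (all; any)
open import Data.Bool.Properties using (T-≡; ⇔→≡)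
open import Data.Empty using (⊥; ⊥-elim)
open import Data.Fin using (Fin; zero; suc; toℕ; _≟_)
import Data.Fin.Properties as Finₚ
open import Data.Fin.Subset using (Subset; _∈_; _∉_; _⊆_; ⁅_⁆; _∪_)
open import Data.Fin.Subset.Properties using (⊆-antisym; x∈⁅x⁆; x∈⁅y⁆⇒x≡y; x≢y⇒x∉⁅y⁆; x∈p∪q⁻; p⊆p∪q; q⊆p∪q; _∈?_)
open import Data.List using (List; []; _∷_; allFin; concatMap; applyUpTo; _∷ʳ_)
import Data.List as List
open import Data.List.Properties using (map-++; applyUpTo-∷ʳ)
open import Data.List.Membership.Propositional using (find) renaming (_∈_ to _∈ₗ_)
open import Data.List.Membership.Propositional.Properties
  using (∈-allFin; ∈-concatMap⁺; ∈-concatMap⁻; ∈-filter⁻; ∈-lookup)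
open import Data.List.Relation.Unary.All as All using ([]; _∷_)
open import Data.List.Relation.Unary.All.Properties using (all⁺; all⁻)
open import Data.List.Relation.Unary.Any as Any using (here; there)
open import Data.List.Relation.Unary.Any.Properties using (any⁺; any⁻)
open import Data.List.Relation.Unary.AllPairs using ([]; _∷_)
open import Data.List.Relation.Unary.Unique.Propositional using (Unique)
import Data.List.Relation.Unary.Unique.Propositional.Properties as Uniqueₚ
open import Data.Nat using (ℕ; zero; suc; _≤_; _<_; _+_; _∸_; pred; s≤s; z≤n)
open import Data.Nat.Induction using (<-rec)
import Data.Nat.Properties as ℕₚ
open import Data.Product using (∃; ∃₂; ∃-syntax; _×_; _,_; proj₁; proj₂)
open import Data.Sum using (_⊎_; inj₁; inj₂; [_,_]′)
open import Data.Vec using (tabulate; tail; []; _∷_)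
open import Data.Vec.Properties using (lookup∘tabulate; []=⇒lookup; lookup⇒[]=)
open import Function using (_∘_; mk⇔; Equivalence)
open import Relation.Binary.PropositionalEquality
open import Relation.Nullary using (¬_; Dec; yes; no; ¬?; contradiction)
open import Relation.Nullary.Decidable using (_×-dec_; _→-dec_; decidable-stable; T?)

∧-true⁻ : ∀ {a b} → a ∧ b ≡ true → a ≡ true × b ≡ true
∧-true⁻ {true} {true} _ = refl , refl

∧-true⁺ : ∀ {a b} → a ≡ true → b ≡ true → a ∧ b ≡ true
∧-true⁺ refl refl = refl

not-true⁻ : ∀ {a} → not a ≡ true → a ≢ true
not-true⁻ {false} _ ()

not-true⁺ : ∀ {a} → a ≢ true → not a ≡ true
not-true⁺ {false} _ = refl
not-true⁺ {true} a≢true = contradiction refl a≢true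

⇒-true⁻ : ∀ {a b} → not a ∨ b ≡ true → a ≡ true → b ≡ true
⇒-true⁻ {true} h refl = h

⇒-true⁺ : ∀ {a b} → (a ≡ true → b ≡ true) → not a ∨ b ≡ true
⇒-true⁺ {false} _ = refl
⇒-true⁺ {true} h = h refl

module _ {A : Set} (p : A → Bool) where

  all-true⁻ : ∀ {xs x} → all p xs ≡ true → x ∈ₗ xs → p x ≡ true
  all-true⁻ {xs} h = Equivalence.to T-≡ ∘ All.lookup (all⁺ p xs (Equivalence.from T-≡ h))

  all-true⁺ : ∀ {xs} → (∀ {x} → x ∈ₗ xs → p x ≡ true) → all p xs ≡ true
  all-true⁺ h = Equivalence.to T-≡ (all⁻ p (All.tabulate (Equivalence.from T-≡ ∘ h)))

  any-true⁻ : ∀ xs → any p xs ≡ true → ∃ λ x → x ∈ₗ xs × p x ≡ true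
  any-true⁻ xs h with x , x∈xs , px ← find (any⁻ p xs (Equivalence.from T-≡ h)) =
    x , x∈xs , Equivalence.to T-≡ px

  any-true⁺ : ∀ {xs x} → x ∈ₗ xs → p x ≡ true → any p xs ≡ true
  any-true⁺ x∈xs px = Equivalence.to T-≡ (any⁺ p (Any.map (λ { refl → Equivalence.from T-≡ px }) x∈xs))

module _ {n} (p : Fin n → Bool) where

  all-allFin⁻ : all p (allFin n) ≡ true → ∀ i → p i ≡ true
  all-allFin⁻ h i = all-true⁻ p h (∈-allFin i)

  all-allFin⁺ : (∀ i → p i ≡ true) → all p (allFin n) ≡ true
  all-allFin⁺ h = all-true⁺ p {allFin n} (λ {i} _ → h i)

  any-allFin⁻ : any p (allFin n) ≡ true → ∃ λ i → p i ≡ true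
  any-allFin⁻ h with i , _ , pi ← any-true⁻ p (allFin n) h = i , pi

  any-allFin⁺ : ∀ i → p i ≡ true → any p (allFin n) ≡ true
  any-allFin⁺ i = any-true⁺ p (∈-allFin i)

lookup-injective : ∀ {A : Set} {xs : List A} → Unique xs →
                   ∀ i j → List.lookup xs i ≡ List.lookup xs j → i ≡ j
lookup-injective {xs = _ ∷ _} _ zero zero _ = refl
lookup-injective {xs = _ ∷ _} (x∉xs ∷ _) zero (suc j) eq = contradiction eq (All.lookup x∉xs (∈-lookup j))
lookup-injective {xs = _ ∷ _} (x∉xs ∷ _) (suc i) zero eq = contradiction (sym eq) (All.lookup x∉xs (∈-lookup i))
lookup-injective {xs = _ ∷ _} (_ ∷ u) (suc i) (suc j) eq = cong suc (lookup-injective u i j eq)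

module _ {n} {S : Subset n} {i : Fin n} where

  ∈ᵇ⇒∈ : i ∈ᵇ S ≡ true → i ∈ S
  ∈ᵇ⇒∈ = lookup⇒[]= i S

  ∈⇒∈ᵇ : i ∈ S → i ∈ᵇ S ≡ true
  ∈⇒∈ᵇ = []=⇒lookup

  ∉⇒∉ᵇ : i ∉ S → i ∈ᵇ S ≢ true
  ∉⇒∉ᵇ i∉S = i∉S ∘ ∈ᵇ⇒∈

diffᵇ⁻ : ∀ {n} {i : Fin n} {S X} → diffᵇ i S X ≡ true → i ∈ S × i ∉ X
diffᵇ⁻ h with i∈S , i∉X ← ∧-true⁻ h = ∈ᵇ⇒∈ i∈S , not-true⁻ i∉X ∘ ∈⇒∈ᵇ

diffᵇ⁺ : ∀ {n} {i : Fin n} {S X} → i ∈ S → i ∉ X → diffᵇ i S X ≡ true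
diffᵇ⁺ i∈S i∉X = ∧-true⁺ (∈⇒∈ᵇ i∈S) (not-true⁺ (∉⇒∉ᵇ i∉X))

⊆ᵇ⇒⊆ : ∀ {n} {S T : Subset n} → (S ⊆ᵇ T) ≡ true → S ⊆ T
⊆ᵇ⇒⊆ {n} {S} {T} h {i} = ∈ᵇ⇒∈ ∘ ⇒-true⁻ (all-allFin⁻ (λ i → not (i ∈ᵇ S) ∨ (i ∈ᵇ T)) h i) ∘ ∈⇒∈ᵇ

⊆⇒⊆ᵇ : ∀ {n} {S T : Subset n} → S ⊆ T → (S ⊆ᵇ T) ≡ true
⊆⇒⊆ᵇ {n} {S} {T} S⊆T = all-allFin⁺ (λ i → not (i ∈ᵇ S) ∨ (i ∈ᵇ T)) λ i → ⇒-true⁺ (∈⇒∈ᵇ ∘ S⊆T ∘ ∈ᵇ⇒∈)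

==ˢ-refl : ∀ {n} (S : Subset n) → (S ==ˢ S) ≡ true
==ˢ-refl [] = refl
==ˢ-refl (true ∷ S) = ==ˢ-refl S
==ˢ-refl (false ∷ S) = ==ˢ-refl S

==ˢ-comm : ∀ {n} (S T : Subset n) → (S ==ˢ T) ≡ (T ==ˢ S)
==ˢ-comm [] [] = refl
==ˢ-comm (a ∷ S) (b ∷ T) = cong₂ _∧_ (eqB-comm a b) (==ˢ-comm S T)
  where
  eqB-comm : ∀ a b → eqB a b ≡ eqB b a
  eqB-comm true true = refl
  eqB-comm true false = refl
  eqB-comm false true = refl
  eqB-comm false false = refl

private
  extensions : ∀ {n} → Subset n → List (Subset (suc n))
  extensions S = (false ∷ S) ∷ (true ∷ S) ∷ []

∈-subsets : ∀ {n} (S : Subset n) → S ∈ₗ subsets n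
∈-subsets [] = here refl
∈-subsets (false ∷ S) = ∈-concatMap⁺ extensions (Any.map (λ { refl → here refl }) (∈-subsets S))
∈-subsets (true ∷ S) = ∈-concatMap⁺ extensions (Any.map (λ { refl → there (here refl) }) (∈-subsets S))

subsets-unique : ∀ n → Unique (subsets n)
subsets-unique zero = [] ∷ []
subsets-unique (suc n) = concatMap-extensions (subsets-unique n)
  where
  ∈-concatMap-extensions⁻ : ∀ {xs} {S : Subset (suc n)} → S ∈ₗ concatMap extensions xs → tail S ∈ₗ xs
  ∈-concatMap-extensions⁻ {xs} = Any.map (λ { (here refl) → refl ; (there (here refl)) → refl }) ∘ ∈-concatMap⁻ extensions {xs = xs}
  concatMap-extensions : ∀ {xs} → Unique xs → Unique (concatMap extensions xs)
  concatMap-extensions [] = []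
  concatMap-extensions {S ∷ xs} (S∉xs ∷ u) = Uniqueₚ.++⁺ (((λ ()) ∷ []) ∷ [] ∷ []) (concatMap-extensions u) disjoint
    where
    disjoint : ∀ {T} → T ∈ₗ extensions S × T ∈ₗ concatMap extensions xs → ⊥
    disjoint (here refl , T∈) = All.lookup S∉xs (∈-concatMap-extensions⁻ T∈) refl
    disjoint (there (here refl) , T∈) = All.lookup S∉xs (∈-concatMap-extensions⁻ T∈) refl

applyUpTo-path : ∀ {G} (f : ℕ → Fin (n G)) → (∀ i → adj G (f i) (f (suc i)) ≡ true) →
                 ∀ l → Path G (applyUpTo f (suc l))
applyUpTo-path f edge zero = single
applyUpTo-path f edge (suc l) = cons (edge 0) (applyUpTo-path (f ∘ suc) (edge ∘ suc) l)

<⇒≡suc+ : ∀ {a b} → a < b → ∃ λ o → b ≡ suc o + a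
<⇒≡suc+ {a} a<b with o , eq ← ℕₚ.m≤n⇒∃[o]m+o≡n a<b = o , trans (sym eq) (cong suc (ℕₚ.+-comm a o))

injective-missing⇒< : ∀ {a b} {f : Fin a → Fin b} → (∀ {i j} → f i ≡ f j → i ≡ j) →
                      ∀ y → (∀ i → f i ≢ y) → a < b
injective-missing⇒< {b = suc _} {f} f-injective y missed =
  s≤s (Finₚ.injective⇒≤ λ {i} {j} eq →
    f-injective (Finₚ.punchOut-injective (missed i ∘ sym) (missed j ∘ sym) eq))

injective-missing⇒≤pred : ∀ {a b} {f : Fin a → Fin b} → (∀ {i j} → f i ≡ f j → i ≡ j) →
                          (Fin b → ∃ λ y → ∀ i → f i ≢ y) → a ≤ pred b
injective-missing⇒≤pred {zero} _ _ = z≤n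
injective-missing⇒≤pred {suc _} {f = f} f-injective missing =
  ℕₚ.<⇒≤pred (injective-missing⇒< f-injective (proj₁ (missing (f zero))) (proj₂ (missing (f zero))))

map-path : ∀ {G H} (f : Fin (n G) → Fin (n H)) →
           (∀ {u v} → adj G u v ≡ true → adj H (f u) (f v) ≡ true) →
           ∀ {xs} → Path G xs → Path H (List.map f xs)
map-path f hom single = single
map-path f hom (cons e p) = cons (hom e) (map-path f hom p)

map-cycle : ∀ {G H} (f : Fin (n G) → Fin (n H)) → (∀ {u v} → f u ≡ f v → u ≡ v) →
            (∀ {u v} → adj G u v ≡ true → adj H (f u) (f v) ≡ true) → Cycle G → Cycle H
map-cycle {G} {H} f f-injective hom C = record
  { first    = f first
  ; middle   = f middle
  ; rest     = List.map f rest
  ; last     = f last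
  ; distinct = subst Unique map-vertices (Uniqueₚ.map⁺ f-injective distinct)
  ; path     = subst (Path H) map-vertices (map-path f hom path)
  ; closing  = hom closing
  }
  where
  open Cycle C
  map-vertices : List.map f (first ∷ middle ∷ rest ∷ʳ last) ≡ f first ∷ f middle ∷ List.map f rest ∷ʳ f last
  map-vertices = cong (λ vs → f first ∷ f middle ∷ vs) (map-++ f rest (last ∷ []))

module Bicliques (G : Graph) where

  Edge : Fin (n G) → Fin (n G) → Set
  Edge u v = adj G u v ≡ true

  record IsBipartition (S X : Subset (n G)) : Set where
    field
      X⊆S           : X ⊆ S
      X-nonempty    : ∃ λ x → x ∈ X
      Y-nonempty    : ∃ λ y → y ∈ S × y ∉ X
      X-independent : ∀ {u v} → u ∈ X → v ∈ X → ¬ Edge u v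
      Y-independent : ∀ {u v} → u ∈ S → u ∉ X → v ∈ S → v ∉ X → ¬ Edge u v
      complete      : ∀ {u v} → u ∈ X → v ∈ S → v ∉ X → Edge u v

  CompleteBipartite : Subset (n G) → Set
  CompleteBipartite S = ∃ (IsBipartition S)

  IsBiclique : Subset (n G) → Set
  IsBiclique S = CompleteBipartite S × (∀ {T} → S ⊆ T → CompleteBipartite T → T ⊆ S)

  ShareEdge : Subset (n G) → Subset (n G) → Set
  ShareEdge S T = ∃₂ λ u v → (u ∈ S × v ∈ S) × (u ∈ T × v ∈ T) × Edge u v

  private
    all²⁻ : ∀ (p : Fin (n G) → Fin (n G) → Bool) →
            all (λ u → all (p u) (allFin (n G))) (allFin (n G)) ≡ true → ∀ u v → p u v ≡ true
    all²⁻ p h u = all-allFin⁻ (p u) (all-allFin⁻ (λ u → all (p u) (allFin (n G))) h u)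

    all²⁺ : ∀ (p : Fin (n G) → Fin (n G) → Bool) →
            (∀ u v → p u v ≡ true) → all (λ u → all (p u) (allFin (n G))) (allFin (n G)) ≡ true
    all²⁺ p h = all-allFin⁺ (λ u → all (p u) (allFin (n G))) λ u → all-allFin⁺ (p u) (h u)

  module _ {S X : Subset (n G)} where

    private
      X-independentᵇ Y-independentᵇ completeᵇ : Fin (n G) → Fin (n G) → Bool
      X-independentᵇ u v = not ((u ∈ᵇ X) ∧ (v ∈ᵇ X) ∧ adj G u v)
      Y-independentᵇ u v = not (diffᵇ u S X ∧ diffᵇ v S X ∧ adj G u v)
      completeᵇ u v      = not ((u ∈ᵇ X) ∧ diffᵇ v S X) ∨ adj G u v

    bipartitionᵇ-sound : bipartitionᵇ G S X ≡ true → IsBipartition S X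
    bipartitionᵇ-sound h
      with X⊆S , h ← ∧-true⁻ h
      with X≠∅ , h ← ∧-true⁻ h
      with Y≠∅ , h ← ∧-true⁻ h
      with X-ind , h ← ∧-true⁻ h
      with Y-ind , full ← ∧-true⁻ h
      = record
      { X⊆S           = ⊆ᵇ⇒⊆ X⊆S
      ; X-nonempty    = let x , x∈X = any-allFin⁻ (_∈ᵇ X) X≠∅ in x , ∈ᵇ⇒∈ x∈X
      ; Y-nonempty    = let y , y∈Y = any-allFin⁻ (λ i → diffᵇ i S X) Y≠∅ in y , diffᵇ⁻ y∈Y
      ; X-independent = λ {u} {v} u∈X v∈X e → not-true⁻ (all²⁻ X-independentᵇ X-ind u v)
                          (∧-true⁺ (∈⇒∈ᵇ u∈X) (∧-true⁺ (∈⇒∈ᵇ v∈X) e))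
      ; Y-independent = λ {u} {v} u∈S u∉X v∈S v∉X e → not-true⁻ (all²⁻ Y-independentᵇ Y-ind u v)
                          (∧-true⁺ (diffᵇ⁺ u∈S u∉X) (∧-true⁺ (diffᵇ⁺ v∈S v∉X) e))
      ; complete      = λ {u} {v} u∈X v∈S v∉X → ⇒-true⁻ (all²⁻ completeᵇ full u v)
                          (∧-true⁺ (∈⇒∈ᵇ u∈X) (diffᵇ⁺ v∈S v∉X))
      }

    bipartitionᵇ-complete : IsBipartition S X → bipartitionᵇ G S X ≡ true
    bipartitionᵇ-complete b
      with x , x∈X ← IsBipartition.X-nonempty b
      with y , y∈S , y∉X ← IsBipartition.Y-nonempty b =
      ∧-true⁺ (⊆⇒⊆ᵇ X⊆S) (
      ∧-true⁺ (any-allFin⁺ (_∈ᵇ X) x (∈⇒∈ᵇ x∈X)) (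
      ∧-true⁺ (any-allFin⁺ (λ i → diffᵇ i S X) y (diffᵇ⁺ y∈S y∉X)) (
      ∧-true⁺ (all²⁺ X-independentᵇ λ u v → not-true⁺ λ h →
                let u∈X , h = ∧-true⁻ h ; v∈X , e = ∧-true⁻ h in
                X-independent (∈ᵇ⇒∈ u∈X) (∈ᵇ⇒∈ v∈X) e) (
      ∧-true⁺ (all²⁺ Y-independentᵇ λ u v → not-true⁺ λ h →
                let u∈Y , h = ∧-true⁻ h ; v∈Y , e = ∧-true⁻ h
                    u∈S , u∉X = diffᵇ⁻ u∈Y ; v∈S , v∉X = diffᵇ⁻ v∈Y in
                Y-independent u∈S u∉X v∈S v∉X e)
              (all²⁺ completeᵇ λ u v → ⇒-true⁺ λ h →
                let u∈X , v∈Y = ∧-true⁻ h ; v∈S , v∉X = diffᵇ⁻ v∈Y in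
                complete (∈ᵇ⇒∈ u∈X) v∈S v∉X)))))
      where open IsBipartition b

  completeBipartiteᵇ-sound : ∀ {S} → completeBipartiteᵇ G S ≡ true → CompleteBipartite S
  completeBipartiteᵇ-sound {S} h with X , _ , b ← any-true⁻ (bipartitionᵇ G S) (subsets (n G)) h =
    X , bipartitionᵇ-sound b

  completeBipartiteᵇ-complete : ∀ {S} → CompleteBipartite S → completeBipartiteᵇ G S ≡ true
  completeBipartiteᵇ-complete {S} (X , b) =
    any-true⁺ (bipartitionᵇ G S) (∈-subsets X) (bipartitionᵇ-complete b)

  isBicliqueᵇ-sound : ∀ {S} → isBicliqueᵇ G S ≡ true → IsBiclique S
  isBicliqueᵇ-sound {S} h with cb , maximal ← ∧-true⁻ h =
    completeBipartiteᵇ-sound cb , λ {T} S⊆T cbT → ⊆ᵇ⇒⊆ (decidable-stable ((T ⊆ᵇ S) Bool.≟ true) λ T⊈S →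
      not-true⁻ (all-true⁻ (λ T → not ((S ⊆ᵇ T) ∧ not (T ⊆ᵇ S) ∧ completeBipartiteᵇ G T)) maximal (∈-subsets T))
                (∧-true⁺ (⊆⇒⊆ᵇ S⊆T) (∧-true⁺ (not-true⁺ T⊈S) (completeBipartiteᵇ-complete cbT))))

  biclique : Fin (n (KBe G)) → Subset (n G)
  biclique = List.lookup (bicliques G)

  biclique-isBiclique : ∀ k → IsBiclique (biclique k)
  biclique-isBiclique k = isBicliqueᵇ-sound (Equivalence.to T-≡
    (proj₂ (∈-filter⁻ (T? ∘ isBicliqueᵇ G) {xs = subsets (n G)} (∈-lookup k))))

  biclique-injective : ∀ {k l} → biclique k ≡ biclique l → k ≡ l
  biclique-injective = lookup-injective (Uniqueₚ.filter⁺ (T? ∘ isBicliqueᵇ G) (subsets-unique (n G))) _ _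

  private
    edgeInᵇ : Subset (n G) → Subset (n G) → Fin (n G) → Fin (n G) → Bool
    edgeInᵇ S T u v = (u ∈ᵇ S) ∧ (v ∈ᵇ S) ∧ (u ∈ᵇ T) ∧ (v ∈ᵇ T) ∧ adj G u v

  shareEdgeᵇ-sound : ∀ {S T} → shareEdgeᵇ G S T ≡ true → ShareEdge S T
  shareEdgeᵇ-sound {S} {T} h
    with u , h ← any-allFin⁻ (λ u → any (edgeInᵇ S T u) (allFin (n G))) h
    with v , h ← any-allFin⁻ (edgeInᵇ S T u) h
    with u∈S , h ← ∧-true⁻ h
    with v∈S , h ← ∧-true⁻ h
    with u∈T , h ← ∧-true⁻ h
    with v∈T , e ← ∧-true⁻ h
    = u , v , (∈ᵇ⇒∈ u∈S , ∈ᵇ⇒∈ v∈S) , (∈ᵇ⇒∈ u∈T , ∈ᵇ⇒∈ v∈T) , e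

  shareEdgeᵇ-complete : ∀ {S T} → ShareEdge S T → shareEdgeᵇ G S T ≡ true
  shareEdgeᵇ-complete {S} {T} (u , v , (u∈S , v∈S) , (u∈T , v∈T) , e) =
    any-allFin⁺ (λ u → any (edgeInᵇ S T u) (allFin (n G))) u (any-allFin⁺ (edgeInᵇ S T u) v
      (∧-true⁺ (∈⇒∈ᵇ u∈S) (∧-true⁺ (∈⇒∈ᵇ v∈S) (∧-true⁺ (∈⇒∈ᵇ u∈T) (∧-true⁺ (∈⇒∈ᵇ v∈T) e)))))

  ShareEdge-sym : ∀ {S T} → ShareEdge S T → ShareEdge T S
  ShareEdge-sym (u , v , S∋uv , T∋uv , e) = u , v , T∋uv , S∋uv , e

  shareEdgeᵇ-comm : ∀ S T → shareEdgeᵇ G S T ≡ shareEdgeᵇ G T S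
  shareEdgeᵇ-comm S T = ⇔→≡ (mk⇔ (swap S T) (swap T S))
    where
    swap : ∀ S T → shareEdgeᵇ G S T ≡ true → shareEdgeᵇ G T S ≡ true
    swap S T = shareEdgeᵇ-complete {T} {S} ∘ ShareEdge-sym ∘ shareEdgeᵇ-sound {S} {T}

  KBe-adj⁻ : ∀ {k l} → adj (KBe G) k l ≡ true → biclique k ≢ biclique l × ShareEdge (biclique k) (biclique l)
  KBe-adj⁻ {k} h with distinct , share ← ∧-true⁻ h =
    (λ eq → not-true⁻ distinct (subst (λ T → (biclique k ==ˢ T) ≡ true) eq (==ˢ-refl (biclique k)))) ,
    shareEdgeᵇ-sound share

  KBe-simple : Simple (KBe G)
  KBe-simple = record
    { symm   = λ k l → cong₂ _∧_ (cong not (==ˢ-comm (biclique k) (biclique l)))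
                                 (shareEdgeᵇ-comm (biclique k) (biclique l))
    ; irrefl = λ k → cong (λ b → not b ∧ shareEdgeᵇ G (biclique k) (biclique k)) (==ˢ-refl (biclique k))
    }

module Forest (G : Graph) (simple : Simple G) (acyclic : Acyclic G) where

  open Bicliques G
  open Simple simple

  Edge⇒≢ : ∀ {u v} → Edge u v → u ≢ v
  Edge⇒≢ {u} e refl with () ← trans (sym e) (irrefl u)

  Edge-sym : ∀ {u v} → Edge u v → Edge v u
  Edge-sym {u} {v} e = trans (symm v u) e

  no-triangle : ∀ {a b c} → Edge a b → Edge b c → Edge c a → ⊥
  no-triangle {a} {b} {c} ab bc ca = acyclic record
    { first = a ; middle = b ; rest = [] ; last = c
    ; distinct = (Edge⇒≢ ab ∷ Edge⇒≢ (Edge-sym ca) ∷ []) ∷ (Edge⇒≢ bc ∷ []) ∷ [] ∷ []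
    ; path = cons ab (cons bc single)
    ; closing = ca
    }

  no-square : ∀ {a b c d} → Edge a b → Edge b c → Edge c d → Edge d a → a ≢ c → b ≢ d → ⊥
  no-square {a} {b} {c} {d} ab bc cd da a≢c b≢d = acyclic record
    { first = a ; middle = b ; rest = c ∷ [] ; last = d
    ; distinct = (Edge⇒≢ ab ∷ a≢c ∷ Edge⇒≢ (Edge-sym da) ∷ []) ∷ (Edge⇒≢ bc ∷ b≢d ∷ []) ∷ (Edge⇒≢ cd ∷ []) ∷ [] ∷ []
    ; path = cons ab (cons bc (cons cd single))
    ; closing = da
    }

  N[_] : Fin (n G) → Subset (n G)
  N[ c ] = ⁅ c ⁆ ∪ tabulate (adj G c)

  c∈N[c] : ∀ c → c ∈ N[ c ]
  c∈N[c] c = p⊆p∪q _ (x∈⁅x⁆ c)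

  Edge⇒∈N[] : ∀ {c v} → Edge c v → v ∈ N[ c ]
  Edge⇒∈N[] {c} {v} e = q⊆p∪q ⁅ c ⁆ _ (lookup⇒[]= v _ (trans (lookup∘tabulate (adj G c) v) e))

  ∈N[]⁻ : ∀ {c v} → v ∈ N[ c ] → v ≡ c ⊎ Edge c v
  ∈N[]⁻ {c} {v} v∈N[c] with x∈p∪q⁻ ⁅ c ⁆ _ v∈N[c]
  ... | inj₁ v∈⁅c⁆ = inj₁ (x∈⁅y⁆⇒x≡y c v∈⁅c⁆)
  ... | inj₂ v∈nbhd = inj₂ (trans (sym (lookup∘tabulate (adj G c) v)) ([]=⇒lookup v∈nbhd))

  ∈N[]-∉⁅⁆⇒Edge : ∀ {c v} → v ∈ N[ c ] → v ∉ ⁅ c ⁆ → Edge c v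
  ∈N[]-∉⁅⁆⇒Edge {c} v∈N[c] v∉⁅c⁆ with ∈N[]⁻ v∈N[c]
  ... | inj₁ refl = contradiction (x∈⁅x⁆ c) v∉⁅c⁆
  ... | inj₂ e = e

  N[]-isBipartition : ∀ {c w} → Edge c w → IsBipartition N[ c ] ⁅ c ⁆
  N[]-isBipartition {c} {w} cw = record
    { X⊆S           = p⊆p∪q _
    ; X-nonempty    = c , x∈⁅x⁆ c
    ; Y-nonempty    = w , Edge⇒∈N[] cw , x≢y⇒x∉⁅y⁆ (Edge⇒≢ cw ∘ sym)
    ; X-independent = λ u∈⁅c⁆ v∈⁅c⁆ uv → Edge⇒≢ uv (trans (x∈⁅y⁆⇒x≡y c u∈⁅c⁆) (sym (x∈⁅y⁆⇒x≡y c v∈⁅c⁆)))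
    ; Y-independent = λ u∈S u∉X v∈S v∉X uv →
        no-triangle (∈N[]-∉⁅⁆⇒Edge u∈S u∉X) uv (Edge-sym (∈N[]-∉⁅⁆⇒Edge v∈S v∉X))
    ; complete      = λ u∈⁅c⁆ v∈S v∉X → subst (λ u → Edge u _) (sym (x∈⁅y⁆⇒x≡y c u∈⁅c⁆)) (∈N[]-∉⁅⁆⇒Edge v∈S v∉X)
    }

  bipartition⇒star : ∀ {S X} → IsBipartition S X → ∃ λ c → S ⊆ N[ c ] × ∃ (Edge c)
  bipartition⇒star {S} {X} b
    with x , x∈X ← IsBipartition.X-nonempty b
    with y , y∈S , y∉X ← IsBipartition.Y-nonempty b
    with Finₚ.any? (λ x′ → (x′ ∈? X) ×-dec ¬? (x′ ≟ x))
  ... | yes (x′ , x′∈X , x′≢x) = y , S⊆N[y] , x , Edge-sym (complete x∈X y∈S y∉X)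
    where
    open IsBipartition b
    S⊆N[y] : S ⊆ N[ y ]
    S⊆N[y] {s} s∈S with s ∈? X | s ≟ y
    ... | yes s∈X | _ = Edge⇒∈N[] (Edge-sym (complete s∈X y∈S y∉X))
    ... | no _ | yes refl = c∈N[c] y
    ... | no s∉X | no s≢y = ⊥-elim (no-square (complete x∈X y∈S y∉X) (Edge-sym (complete x′∈X y∈S y∉X))
                                              (complete x′∈X s∈S s∉X) (Edge-sym (complete x∈X s∈S s∉X))
                                              (x′≢x ∘ sym) (s≢y ∘ sym))
  ... | no X⊆⁅x⁆ = x , S⊆N[x] , y , complete x∈X y∈S y∉X
    where
    open IsBipartition b
    S⊆N[x] : S ⊆ N[ x ]
    S⊆N[x] {s} s∈S with s ∈? X
    ... | yes s∈X = subst (_∈ N[ x ]) (sym (decidable-stable (s ≟ x) λ s≢x → X⊆⁅x⁆ (s , s∈X , s≢x))) (c∈N[c] x)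
    ... | no s∉X = Edge⇒∈N[] (complete x∈X s∈S s∉X)

  biclique⇒N[] : ∀ {S} → IsBiclique S → ∃ λ c → S ≡ N[ c ] × ∃ (Edge c)
  biclique⇒N[] ((_ , b) , maximal) with c , S⊆N[c] , w , cw ← bipartition⇒star b =
    c , ⊆-antisym S⊆N[c] (maximal S⊆N[c] (⁅ c ⁆ , N[]-isBipartition cw)) , w , cw

  -- Implicit arguments that would have to be unified against a term containing centre are
  -- passed explicitly below: solving them makes Agda unfold centre, which is very slow.
  centre : Fin (n (KBe G)) → Fin (n G)
  centre k = proj₁ (biclique⇒N[] (biclique-isBiclique k))

  biclique≡N[centre] : ∀ k → biclique k ≡ N[ centre k ]
  biclique≡N[centre] k = proj₁ (proj₂ (biclique⇒N[] (biclique-isBiclique k)))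

  centre-non-isolated : ∀ k → ∃ (Edge (centre k))
  centre-non-isolated k = proj₂ (proj₂ (biclique⇒N[] (biclique-isBiclique k)))

  NotCentre : Fin (n G) → Set
  NotCentre y = ∀ k → centre k ≢ y

  centre-maximal : ∀ {k w T} → centre k ≡ w → N[ w ] ⊆ T → CompleteBipartite T → T ⊆ N[ w ]
  centre-maximal {k} {w} {T} ck≡w N[w]⊆T cbT =
    subst (T ⊆_) biclique≡N[w] (proj₂ (biclique-isBiclique k) (subst (_⊆ T) (sym biclique≡N[w]) N[w]⊆T) cbT)
    where
    biclique≡N[w] : biclique k ≡ N[ w ]
    biclique≡N[w] = trans (biclique≡N[centre] k) (cong N[_] ck≡w)

  N[centre]-injective : ∀ {k l} → N[ centre k ] ≡ N[ centre l ] → k ≡ l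
  N[centre]-injective {k} {l} eq =
    biclique-injective (trans (biclique≡N[centre] k) (trans eq (sym (biclique≡N[centre] l))))

  centre-injective : ∀ {k l} → centre k ≡ centre l → k ≡ l
  centre-injective eq = N[centre]-injective (cong N[_] eq)

  ∈biclique⇒∈N[centre] : ∀ k {x} → x ∈ biclique k → x ∈ N[ centre k ]
  ∈biclique⇒∈N[centre] k = subst (_ ∈_) (biclique≡N[centre] k)

  edge-in-N[]⁻ : ∀ {a u v} → u ∈ N[ a ] → v ∈ N[ a ] → Edge u v → u ≡ a ⊎ v ≡ a
  edge-in-N[]⁻ u∈N[a] v∈N[a] uv with ∈N[]⁻ u∈N[a] | ∈N[]⁻ v∈N[a]
  ... | inj₁ u≡a | _ = inj₁ u≡a
  ... | inj₂ _ | inj₁ v≡a = inj₂ v≡a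
  ... | inj₂ au | inj₂ av = ⊥-elim (no-triangle au uv (Edge-sym av))

  edge-between : ∀ {a b u v} → a ≢ b → Edge u v → u ≡ a ⊎ v ≡ a → u ≡ b ⊎ v ≡ b → Edge a b
  edge-between a≢b uv (inj₁ refl) (inj₂ refl) = uv
  edge-between a≢b uv (inj₂ refl) (inj₁ refl) = Edge-sym uv
  edge-between a≢b uv (inj₁ u≡a) (inj₁ u≡b) = ⊥-elim (a≢b (trans (sym u≡a) u≡b))
  edge-between a≢b uv (inj₂ v≡a) (inj₂ v≡b) = ⊥-elim (a≢b (trans (sym v≡a) v≡b))

  centre-homomorphism : ∀ {k l} → adj (KBe G) k l ≡ true → Edge (centre k) (centre l)
  centre-homomorphism {k} {l} h = edge (KBe-adj⁻ {k} {l} h)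
    where
    edge : biclique k ≢ biclique l × ShareEdge (biclique k) (biclique l) → Edge (centre k) (centre l)
    edge (distinct , u , v , (u∈k , v∈k) , (u∈l , v∈l) , uv) =
      edge-between (λ eq → distinct (cong biclique (centre-injective {k} {l} eq))) uv
        (edge-in-N[]⁻ {centre k} (∈biclique⇒∈N[centre] k u∈k) (∈biclique⇒∈N[centre] k v∈k) uv)
        (edge-in-N[]⁻ {centre l} (∈biclique⇒∈N[centre] l u∈l) (∈biclique⇒∈N[centre] l v∈l) uv)

  KBe-acyclic : Acyclic (KBe G)
  KBe-acyclic = acyclic ∘ map-cycle {KBe G} {G} centre centre-injective centre-homomorphism

  edge? : ∀ u v → Dec (Edge u v)
  edge? u v = adj G u v Bool.≟ true

  HasDegree≤1 : Fin (n G) → Set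
  HasDegree≤1 w = ∀ u v → Edge w u → Edge w v → u ≡ v

  hasDegree≤1? : ∀ w → Dec (HasDegree≤1 w)
  hasDegree≤1? w = Finₚ.all? λ u → Finₚ.all? λ v → edge? w u →-dec (edge? w v →-dec (u ≟ v))

  module NonBacktrackingWalk
      {u₀ v₀} (e₀ : Edge u₀ v₀)
      (continue : ∀ {p c} → Edge p c → ∃ λ v → Edge c v × v ≢ p) where

    Arc : Set
    Arc = ∃₂ Edge

    next : Arc → Arc
    next (_ , c , e) = c , proj₁ (continue e) , proj₁ (proj₂ (continue e))

    arc : ℕ → Arc
    arc zero = u₀ , v₀ , e₀
    arc (suc k) = next (arc k)

    x : ℕ → Fin (n G)
    x = proj₁ ∘ arc

    x-edge : ∀ k → Edge (x k) (x (suc k))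
    x-edge k = proj₂ (proj₂ (arc k))

    x-no-backtrack : ∀ k → x (suc (suc k)) ≢ x k
    x-no-backtrack k = proj₂ (proj₂ (continue (x-edge k)))

    -- Induction on the gap: a first return after d + 1 ≥ 3 steps closes a cycle.
    x-no-return : ∀ d a → x a ≢ x (suc d + a)
    x-no-return = <-rec (λ d → ∀ a → x a ≢ x (suc d + a)) no-return
      where
      no-return : ∀ d → (∀ {e} → e < d → ∀ a → x a ≢ x (suc e + a)) → ∀ a → x a ≢ x (suc d + a)
      no-return zero _ a = Edge⇒≢ (x-edge a)
      no-return (suc zero) _ a = x-no-backtrack a ∘ sym
      no-return (suc (suc r)) shorter a eq = acyclic record
        { first    = x a
        ; middle   = x (suc a)
        ; rest     = applyUpTo (λ i → x (2 + i + a)) r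
        ; last     = x (2 + r + a)
        ; distinct = subst Unique segment (Uniqueₚ.applyUpTo⁺₁ (λ i → x (i + a)) (3 + r) window)
        ; path     = subst (Path G) segment (applyUpTo-path (λ i → x (i + a)) (λ i → x-edge (i + a)) (2 + r))
        ; closing  = subst (Edge _) (sym eq) (x-edge (2 + r + a))
        }
        where
        segment : applyUpTo (λ i → x (i + a)) (3 + r)
                ≡ x a ∷ x (suc a) ∷ applyUpTo (λ i → x (2 + i + a)) r ∷ʳ x (2 + r + a)
        segment = cong (λ vs → x a ∷ x (suc a) ∷ vs) (sym (applyUpTo-∷ʳ (λ i → x (2 + i + a)) r))
        window : ∀ {i j} → i < j → j < 3 + r → x (i + a) ≢ x (j + a)
        window {i} i<j j<3+r with o , refl ← <⇒≡suc+ i<j = λ eq′ →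
          shorter (s≤s (ℕₚ.m+n≤o⇒m≤o o (ℕₚ.≤-pred (ℕₚ.≤-pred j<3+r)))) (i + a)
                  (trans eq′ (cong x (ℕₚ.+-assoc (suc o) i a)))

    walk-absurd : ⊥
    walk-absurd
      with i , j , i<j , eq ← Finₚ.pigeonhole (ℕₚ.n<1+n (n G)) (x ∘ toℕ)
      with o , j≡ ← <⇒≡suc+ i<j
      = x-no-return o (toℕ i) (trans eq (cong x j≡))

  ∃-degree≤1 : Fin (n G) → ∃ HasDegree≤1
  ∃-degree≤1 w₀ with Finₚ.any? hasDegree≤1?
  ... | yes found = found
  ... | no none with Finₚ.any? (edge? w₀)
  ...   | no isolated = contradiction (w₀ , λ u _ w₀u _ → contradiction (u , w₀u) isolated) none
  ...   | yes (_ , e₀) = ⊥-elim (NonBacktrackingWalk.walk-absurd e₀ continue)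
    where
    continue : ∀ {p c} → Edge p c → ∃ λ v → Edge c v × v ≢ p
    continue {p} {c} _ with Finₚ.any? (λ v → edge? c v ×-dec ¬? (v ≟ p))
    ... | yes found = found
    ... | no only-p = contradiction (c , λ u v cu cv → trans (is-p cu) (sym (is-p cv))) none
      where
      is-p : ∀ {u} → Edge c u → u ≡ p
      is-p {u} cu = decidable-stable (u ≟ p) λ u≢p → only-p (u , cu , u≢p)

  N[leaf]⊆N[neighbour] : ∀ {w u} → HasDegree≤1 w → Edge w u → N[ w ] ⊆ N[ u ]
  N[leaf]⊆N[neighbour] {w} {u} w-degree≤1 wu {s} s∈N[w] with ∈N[]⁻ {w} s∈N[w]
  ... | inj₁ refl = Edge⇒∈N[] {u} (Edge-sym wu)
  ... | inj₂ ws = subst (_∈ N[ u ]) (w-degree≤1 u s wu ws) (c∈N[c] u)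

  pendant-not-centre : ∀ {w u z} → HasDegree≤1 w → Edge w u → Edge u z → z ≢ w → NotCentre w
  pendant-not-centre {w} {u} {z} w-degree≤1 wu uz z≢w k ck≡w =
    [ z≢w , (λ wz → Edge⇒≢ uz (w-degree≤1 u z wu wz)) ]′ (∈N[]⁻ {w} z∈N[w])
    where
    z∈N[w] : z ∈ N[ w ]
    z∈N[w] = centre-maximal ck≡w (N[leaf]⊆N[neighbour] w-degree≤1 wu)
                            (⁅ u ⁆ , N[]-isBipartition uz) (Edge⇒∈N[] {u} uz)

  isolated-edge-has-non-centre : ∀ {w u} → HasDegree≤1 w → Edge w u → (∀ z → Edge u z → z ≡ w) →
                                 ∃ NotCentre
  isolated-edge-has-non-centre {w} {u} w-degree≤1 wu u-only-w = non-centre (Finₚ.any? (λ k → centre k ≟ w))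
    where
    N[w]≡N[u] : N[ w ] ≡ N[ u ]
    N[w]≡N[u] = ⊆-antisym (N[leaf]⊆N[neighbour] w-degree≤1 wu)
                          (N[leaf]⊆N[neighbour] (λ a b ua ub → trans (u-only-w a ua) (sym (u-only-w b ub))) (Edge-sym wu))
    non-centre : Dec (∃ λ k → centre k ≡ w) → ∃ NotCentre
    non-centre (no w-not-centre) = w , λ k ck≡w → w-not-centre (k , ck≡w)
    non-centre (yes (k , ck≡w)) = u , u-not-centre
      where
      u-not-centre : NotCentre u
      u-not-centre l cl≡u = Edge⇒≢ wu (begin
        w        ≡⟨ sym ck≡w ⟩
        centre k ≡⟨ cong centre (N[centre]-injective N[ck]≡N[cl]) ⟩
        centre l ≡⟨ cl≡u ⟩
        u        ∎)
        where
        open ≡-Reasoning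
        N[ck]≡N[cl] : N[ centre k ] ≡ N[ centre l ]
        N[ck]≡N[cl] = trans (cong N[_] ck≡w) (trans N[w]≡N[u] (cong N[_] (sym cl≡u)))

  leaf-has-non-centre : ∀ {w} → HasDegree≤1 w → ∃ NotCentre
  leaf-has-non-centre {w} w-degree≤1 = by-neighbour (Finₚ.any? (edge? w))
    where
    by-neighbour : Dec (∃ (Edge w)) → ∃ NotCentre
    by-neighbour (no isolated) =
      w , λ k ck≡w → isolated (subst (λ c → ∃ (Edge c)) ck≡w (centre-non-isolated k))
    by-neighbour (yes (u , wu)) = by-second-neighbour (Finₚ.any? (λ z → edge? u z ×-dec ¬? (z ≟ w)))
      where
      by-second-neighbour : Dec (∃ λ z → Edge u z × z ≢ w) → ∃ NotCentre
      by-second-neighbour (yes (_ , uz , z≢w)) = w , pendant-not-centre w-degree≤1 wu uz z≢w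
      by-second-neighbour (no u-only-w) = isolated-edge-has-non-centre w-degree≤1 wu λ z uz →
        decidable-stable (z ≟ w) λ z≢w → u-only-w (z , uz , z≢w)

  KBe-shrinks : n (KBe G) ≤ pred (n G)
  KBe-shrinks = injective-missing⇒≤pred {f = centre} centre-injective
                                        (leaf-has-non-centre ∘ proj₂ ∘ ∃-degree≤1)

KBe^-simple : ∀ {G} k → Simple G → Simple (KBe^ k G)
KBe^-simple zero simple = simple
KBe^-simple {G} (suc k) _ = Bicliques.KBe-simple (KBe^ k G)

KBe^-acyclic : ∀ {G} k → Simple G → Acyclic G → Acyclic (KBe^ k G)
KBe^-acyclic zero _ acyclic = acyclic
KBe^-acyclic {G} (suc k) simple acyclic =
  Forest.KBe-acyclic (KBe^ k G) (KBe^-simple k simple) (KBe^-acyclic k simple acyclic)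

n-KBe^-≤ : ∀ {G} k → Simple G → Acyclic G → n (KBe^ k G) ≤ n G ∸ k
n-KBe^-≤ zero _ _ = ℕₚ.≤-refl
n-KBe^-≤ {G} (suc k) simple acyclic = begin
  n (KBe (KBe^ k G))  ≤⟨ Forest.KBe-shrinks (KBe^ k G) (KBe^-simple k simple) (KBe^-acyclic k simple acyclic) ⟩
  pred (n (KBe^ k G)) ≤⟨ ℕₚ.pred-mono-≤ (n-KBe^-≤ k simple acyclic) ⟩
  pred (n G ∸ k)      ≡⟨ ℕₚ.pred[m∸n]≡m∸[1+n] (n G) k ⟩
  n G ∸ suc k         ∎
  where open ℕₚ.≤-Reasoning

corollary3 : (T : Graph) → IsTree T → ∃[ K ] ((k : ℕ) → K ≤ k → n (KBe^ k T) ≡ 0)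
corollary3 T (simple , _ , acyclic) = n T , λ k n≤k →
  ℕₚ.n≤0⇒n≡0 (ℕₚ.≤-trans (n-KBe^-≤ k simple acyclic) (ℕₚ.≤-reflexive (ℕₚ.m≤n⇒m∸n≡0 n≤k)))
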